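{- Any Monte Carlo algorithm for (the reporting variant of) Generalised Pattern Matching with constant error probability $\varepsilon<1/2$ requires $\Omega(\mathcal{S})$ time, where $\mathcal{S}$ is the number of edges in the matching graph.
   Context: Generalised Pattern Matching (GPM): the input is a text $T\in\Sigma_T^n$, a pattern $P\in\Sigma_P^m$, and a matching relationship $M\subseteq\Sigma_T\times\Sigma_P$, viewed as a bipartite graph (the matching graph) on $\Sigma_T\cup\Sigma_P$. Reporting variant: output all $i\in[n-m+1]$ such that $T[i+j-1]$ matches $P[j]$ for all $j\in[m]$. The algorithm may access the matching graph only through oracles answering in $\mathcal{O}(1)$ time: (1) whether $a\in\Sigma_T$ and $b\in\Sigma_P$ match; (2) the degree of a given character; (3) the $k$-th neighbour of a given $a\in\Sigma_T$. -}

module Defs where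

open import Data.Nat using (ℕ; zero; suc; _+_; _*_; _≤_; _<_; _^_)
open import Data.Fin using (Fin; toℕ)
open import Data.Fin.Properties using () renaming (_≟_ to _≟F_)
open import Data.Bool using (Bool)
open import Data.Maybe using (Maybe; just; nothing)
open import Data.List using (List; []; _∷_; length; filter; head; drop; allFin; map)
open import Data.Nat.ListAction using (sum)
open import Data.List.Membership.Propositional using (_∈_)
open import Data.List.Membership.DecPropositional using () renaming (_∈?_ to mem?)
open import Data.List.Relation.Unary.Unique.Propositional using (Unique)
open import Data.Vec using (Vec; lookup)
open import Data.Product using (Σ; _×_; _,_; ∃)
open import Data.Empty using (⊥)
open import Relation.Nullary using (does)

-- Matching graph on Σ_T = Fin σT and Σ_P = Fin σP, presented by adjacency
-- lists of the text characters (the list order fixes the "k-th neighbour").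
record Graph (σT σP : ℕ) : Set where
  field
    adj    : Fin σT → List (Fin σP)
    adjUniq : ∀ a → Unique (adj a)
open Graph public

Matches : ∀ {σT σP} → Graph σT σP → Fin σT → Fin σP → Set
Matches G a b = b ∈ adj G a

edges : ∀ {σT σP} → Graph σT σP → ℕ
edges {σT} G = sum (map (λ a → length (adj G a)) (allFin σT))

matchOracle : ∀ {σT σP} → Graph σT σP → Fin σT → Fin σP → Bool
matchOracle G a b = does (mem? _≟F_ b (adj G a))

degT : ∀ {σT σP} → Graph σT σP → Fin σT → ℕ
degT G a = length (adj G a)

degP : ∀ {σT σP} → Graph σT σP → Fin σP → ℕ
degP {σT} G b = length (filter (λ a → mem? _≟F_ b (adj G a)) (allFin σT))

-- k-th neighbour (0-indexed); nothing if k ≥ degree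
nbr : ∀ {σT σP} → Graph σT σP → Fin σT → ℕ → Maybe (Fin σP)
nbr G a k = head (drop k (adj G a))

record Instance : Set where
  field
    σT σP n m : ℕ
    T : Vec (Fin σT) n
    P : Vec (Fin σP) m
    G : Graph σT σP
open Instance public

_!?_ : ∀ {A : Set} {n} → Vec A n → ℕ → Maybe A
Vec.[] !? _ = nothing
(x Vec.∷ xs) !? zero = just x
(x Vec.∷ xs) !? suc i = xs !? i

MatchAt : ∀ {σT σP} → Graph σT σP → Maybe (Fin σT) → Fin σP → Set
MatchAt G (just a) b = Matches G a b
MatchAt G nothing b = ⊥

Occ : Instance → ℕ → Set
Occ I i = (i + m I ≤ n I) × (∀ (j : Fin (m I)) → MatchAt (G I) (T I !? (i + toℕ j)) (lookup (P I) j))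

CorrectOutput : Instance → List ℕ → Set
CorrectOutput I out = ∀ i → (i ∈ out → Occ I i) × (Occ I i → i ∈ out)

-- Deterministic oracle algorithm (decision tree) over alphabets Fin σT, Fin σP.
data Tree (σT σP : ℕ) : Set where
  leaf   : List ℕ → Tree σT σP
  qMatch : Fin σT → Fin σP → (Bool → Tree σT σP) → Tree σT σP
  qDegT  : Fin σT → (ℕ → Tree σT σP) → Tree σT σP
  qDegP  : Fin σP → (ℕ → Tree σT σP) → Tree σT σP
  qNbr   : Fin σT → ℕ → (Maybe (Fin σP) → Tree σT σP) → Tree σT σP

output : ∀ {σT σP} → Graph σT σP → Tree σT σP → List ℕ
output G (leaf o) = o
output G (qMatch a b k) = output G (k (matchOracle G a b))
output G (qDegT a k) = output G (k (degT G a))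
output G (qDegP b k) = output G (k (degP G b))
output G (qNbr a i k) = output G (k (nbr G a i))

-- number of oracle calls made (each costs one unit of time)
cost : ∀ {σT σP} → Graph σT σP → Tree σT σP → ℕ
cost G (leaf o) = 0
cost G (qMatch a b k) = suc (cost G (k (matchOracle G a b)))
cost G (qDegT a k) = suc (cost G (k (degT G a)))
cost G (qDegP b k) = suc (cost G (k (degP G b)))
cost G (qNbr a i k) = suc (cost G (k (nbr G a i)))

-- Randomised (Monte Carlo) algorithm: given alphabet sizes, T and P (read
-- directly), it chooses a number r of random bits and, for each seed in
-- {0,1}^r (uniform), a deterministic oracle decision tree.
Alg : Set
Alg = (σT σP n m : ℕ) → Vec (Fin σT) n → Vec (Fin σP) m →
      Σ ℕ (λ r → Vec Bool r → Tree σT σP)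

seeds : Alg → Instance → ℕ
seeds A I with A (σT I) (σP I) (n I) (m I) (T I) (P I)
... | r , _ = r

treeOf : (A : Alg) (I : Instance) → Vec Bool (seeds A I) → Tree (σT I) (σP I)
treeOf A I with A (σT I) (σP I) (n I) (m I) (T I) (P I)
... | r , t = t

-- Error probability at most p/q on every instance: a set of at least a
-- (1 - p/q)-fraction of the 2^r seeds yields the correct output.
ErrorAtMost : Alg → ℕ → ℕ → Set
ErrorAtMost A p q = ∀ (I : Instance) →
  Σ (List (Vec Bool (seeds A I))) λ good →
    Unique good ×
    (q * 2 ^ seeds A I ≤ p * 2 ^ seeds A I + q * length good) ×
    (∀ s → s ∈ good → CorrectOutput I (output (G I) (treeOf A I s)))

WorstTimeAtLeast : Alg → Instance → ℕ → ℕ → Set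
WorstTimeAtLeast A I c1 c2 =
  ∃ λ (s : Vec Bool (seeds A I)) → c1 * edges (G I) ≤ c2 * cost (G I) (treeOf A I s)

-- Hard family: on K characters let text = pattern = 0 1 ⋯ K-1.  With the
-- identity matching graph (S = K edges) the pattern occurs at position 0;
-- deleting the single loop (k, k) destroys that occurrence but changes only
-- the answers of queries inspecting character k.  So a seed whose run is
-- correct both on the identity instance and on the k-th variant must query
-- k (unqueried-agree).  Every instance has at least a (1 - p/q) fraction of
-- good seeds; averaging over the K pairs (identity, variant k) gives a seed
-- good on the identity instance and on at least K/q variants (good-seed,
-- whose arithmetic is score-dichotomy).  Its run queries at least K/q
-- distinct characters, hence costs at least S/q (∑-queries).
module Submission where

open import Defs
open import Data.Nat using (ℕ; _+_; _*_; _≤_; _<_)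
open import Data.Product using (Σ; _×_; ∃)

open import Data.Nat using (zero; suc; z≤n; s≤s; _^_; NonZero; >-nonZero)
open import Data.Nat.Properties
open import Data.Nat.Tactic.RingSolver using (solve-∀; solve)
open import Data.Bool using (Bool; true; false; if_then_else_) renaming (_≟_ to _≟B_)
open import Data.Fin using (Fin; zero; suc; toℕ)
open import Data.Fin.Properties using () renaming (_≟_ to _≟F_)
open import Data.List using (List; []; _∷_; length; map; _++_; head; drop; allFin)
open import Data.List.Properties using (length-map; length-++; length-tabulate; filter-≐)
open import Data.Nat.ListAction using (sum)
open import Data.List.Membership.Propositional using (_∈_)
open import Data.List.Membership.Propositional.Properties using (∈-map⁺; ∈-++⁺ˡ; ∈-++⁺ʳ)
import Data.List.Membership.DecPropositional as DecMembership
open import Data.List.Relation.Unary.Any using (here; there)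
open import Data.List.Relation.Unary.AllPairs using ([]; _∷_)
open import Data.List.Relation.Unary.All using ([]) renaming (lookup to lookupAll)
open import Data.List.Relation.Unary.Unique.Propositional using (Unique)
open import Data.Vec using (Vec; lookup; replicate) renaming (_∷_ to _∷v_; [] to []v; allFin to allFinV)
open import Data.Vec.Properties using (lookup-allFin; ≡-dec)
open import Data.Product using (_,_; proj₁; proj₂)
open import Data.Maybe using (just)
open import Relation.Nullary using (Dec; yes; no; does; ¬_; contradiction)
open import Relation.Binary.Definitions using (DecidableEquality)
open import Relation.Unary using (_≐_)
open import Relation.Binary.PropositionalEquality
open import Algebra.Properties.CommutativeMonoid.Sum +-0-commutativeMonoid
  using (sum-syntax; ∑-distrib-+; sum-replicate-zero)
open import Algebra.Properties.Semiring.Sum +-*-semiring using (*-distribˡ-sum)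

𝟙 : {P : Set} → Dec P → ℕ
𝟙 d = if does d then 1 else 0

𝟙-yes : {P : Set} (d : Dec P) → P → 𝟙 d ≡ 1
𝟙-yes (yes _) _ = refl
𝟙-yes (no ¬p) p = contradiction p ¬p

𝟙-no : {P : Set} (d : Dec P) → ¬ P → 𝟙 d ≡ 0
𝟙-no (yes p) ¬p = contradiction p ¬p
𝟙-no (no _) _ = refl

𝟙≤1 : {P : Set} (d : Dec P) → 𝟙 d ≤ 1
𝟙≤1 (yes _) = s≤s z≤n
𝟙≤1 (no _) = z≤n

𝟙≡0⇒¬ : {P : Set} (d : Dec P) → 𝟙 d ≡ 0 → ¬ P
𝟙≡0⇒¬ d 𝟙d≡0 p = 1≢0 (trans (sym (𝟙-yes d p)) 𝟙d≡0)
  where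
  1≢0 : 1 ≢ 0
  1≢0 ()

𝟙-witness : {P : Set} (d : Dec P) → 0 < 𝟙 d → P
𝟙-witness (yes p) _ = p
𝟙-witness (no _) ()

𝟙-mono : {P Q : Set} → (P → Q) → (dP : Dec P) (dQ : Dec Q) → 𝟙 dP ≤ 𝟙 dQ
𝟙-mono P⇒Q (yes p) dQ = ≤-reflexive (sym (𝟙-yes dQ (P⇒Q p)))
𝟙-mono P⇒Q (no _) dQ = z≤n

∑-mono-≤ : ∀ {n} (f g : Fin n → ℕ) → (∀ i → f i ≤ g i) → ∑[ i < n ] f i ≤ ∑[ i < n ] g i
∑-mono-≤ {zero} f g f≤g = z≤n
∑-mono-≤ {suc n} f g f≤g =
  +-mono-≤ (f≤g zero) (∑-mono-≤ (λ i → f (suc i)) (λ i → g (suc i)) (λ i → f≤g (suc i)))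

∑-const : ∀ n c → ∑[ i < n ] c ≡ n * c
∑-const zero c = refl
∑-const (suc n) c = cong (c +_) (∑-const n c)

∑-𝟙≟ : ∀ {n} (a : Fin n) → ∑[ k < n ] 𝟙 (a ≟F k) ≡ 1
∑-𝟙≟ {suc n} zero = cong suc (sum-replicate-zero n)
∑-𝟙≟ {suc n} (suc a) = ∑-𝟙≟ a

sumOver : {X : Set} → List X → (X → ℕ) → ℕ
sumOver [] f = 0
sumOver (x ∷ xs) f = f x + sumOver xs f

module _ {X : Set} where

  sumOver-mono-≤ : ∀ xs (f g : X → ℕ) → (∀ x → f x ≤ g x) → sumOver xs f ≤ sumOver xs g
  sumOver-mono-≤ [] f g f≤g = z≤n
  sumOver-mono-≤ (x ∷ xs) f g f≤g = +-mono-≤ (f≤g x) (sumOver-mono-≤ xs f g f≤g)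

  sumOver-mono-< : ∀ xs (f g : X → ℕ) → (∀ x → f x ≤ g x) →
                   ∀ {y} → y ∈ xs → f y < g y → sumOver xs f < sumOver xs g
  sumOver-mono-< (x ∷ xs) f g f≤g (here refl) fy<gy = +-mono-<-≤ fy<gy (sumOver-mono-≤ xs f g f≤g)
  sumOver-mono-< (x ∷ xs) f g f≤g (there y∈xs) fy<gy = +-mono-≤-< (f≤g x) (sumOver-mono-< xs f g f≤g y∈xs fy<gy)

  sumOver-+ : ∀ xs (f g : X → ℕ) → sumOver xs (λ x → f x + g x) ≡ sumOver xs f + sumOver xs g
  sumOver-+ [] f g = refl
  sumOver-+ (x ∷ xs) f g = begin
    (f x + g x) + sumOver xs (λ x → f x + g x)  ≡⟨ cong (f x + g x +_) (sumOver-+ xs f g) ⟩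
    (f x + g x) + (sumOver xs f + sumOver xs g) ≡⟨ +-+-interchange (f x) (g x) _ _ ⟩
    (f x + sumOver xs f) + (g x + sumOver xs g) ∎
    where open ≡-Reasoning
          +-+-interchange : ∀ a b c d → (a + b) + (c + d) ≡ (a + c) + (b + d)
          +-+-interchange = solve-∀

  sumOver-∑ : ∀ xs {n} (f : X → Fin n → ℕ) → sumOver xs (λ x → ∑[ k < n ] f x k) ≡ ∑[ k < n ] sumOver xs (λ x → f x k)
  sumOver-∑ [] {n} f = sym (sum-replicate-zero n)
  sumOver-∑ (x ∷ xs) {n} f = begin
    ∑[ k < n ] f x k + sumOver xs (λ y → ∑[ k < n ] f y k) ≡⟨ cong (∑[ k < n ] f x k +_) (sumOver-∑ xs f) ⟩
    ∑[ k < n ] f x k + ∑[ k < n ] sumOver xs (λ y → f y k) ≡⟨ sym (∑-distrib-+ (f x) _) ⟩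
    ∑[ k < n ] (f x k + sumOver xs (λ y → f y k))          ∎
    where open ≡-Reasoning

  sumOver≤max : (f : X → ℕ) → X → ∀ xs → Σ X λ y → sumOver xs f ≤ length xs * f y
  sumOver≤max f x₀ [] = x₀ , z≤n
  sumOver≤max f x₀ (x ∷ xs) with sumOver≤max f x₀ xs
  ... | y , bound with f x ≤? f y
  ...   | yes fx≤fy = y , +-mono-≤ fx≤fy bound
  ...   | no fx≰fy = x , +-mono-≤ ≤-refl (≤-trans bound (*-monoʳ-≤ (length xs) (<⇒≤ (≰⇒> fx≰fy))))

module Counting {X : Set} (_≟_ : DecidableEquality X) where

  open DecMembership _≟_ using (_∈?_)

  length≤count : ∀ V → (∀ x → x ∈ V) → ∀ {g} → Unique g → length g ≤ sumOver V (λ s → 𝟙 (s ∈? g))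
  length≤count V complete {[]} _ = z≤n
  length≤count V complete {x ∷ g} (x∉g ∷ unique-g) =
    ≤-trans (s≤s (length≤count V complete unique-g))
      (sumOver-mono-< V _ _ (λ s → 𝟙-mono there (s ∈? g) (s ∈? (x ∷ g))) (complete x) new-at-x)
    where
    new-at-x : 𝟙 (x ∈? g) < 𝟙 (x ∈? (x ∷ g))
    new-at-x rewrite 𝟙-no (x ∈? g) (λ x∈g → lookupAll x∉g x∈g refl)
                   | 𝟙-yes (x ∈? (x ∷ g)) (here refl) = s≤s z≤n

allSeeds : ∀ r → List (Vec Bool r)
allSeeds zero = []v ∷ []
allSeeds (suc r) = map (true ∷v_) (allSeeds r) ++ map (false ∷v_) (allSeeds r)

allSeeds-complete : ∀ r (v : Vec Bool r) → v ∈ allSeeds r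
allSeeds-complete zero []v = here refl
allSeeds-complete (suc r) (true ∷v v) = ∈-++⁺ˡ (∈-map⁺ (true ∷v_) (allSeeds-complete r v))
allSeeds-complete (suc r) (false ∷v v) =
  ∈-++⁺ʳ (map (true ∷v_) (allSeeds r)) (∈-map⁺ (false ∷v_) (allSeeds-complete r v))

allSeeds-length : ∀ r → length (allSeeds r) ≡ 2 ^ r
allSeeds-length zero = refl
allSeeds-length (suc r) = begin
  length (map (true ∷v_) (allSeeds r) ++ map (false ∷v_) (allSeeds r))
    ≡⟨ length-++ (map (true ∷v_) (allSeeds r)) ⟩
  length (map (true ∷v_) (allSeeds r)) + length (map (false ∷v_) (allSeeds r))
    ≡⟨ cong₂ _+_ (length-map (true ∷v_) (allSeeds r)) (length-map (false ∷v_) (allSeeds r)) ⟩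
  length (allSeeds r) + length (allSeeds r)
    ≡⟨ cong₂ _+_ (allSeeds-length r) (trans (allSeeds-length r) (sym (+-identityʳ (2 ^ r)))) ⟩
  2 ^ r + (2 ^ r + 0) ∎
  where open ≡-Reasoning

-- A seed whose score is
-- K·i + c (i ≤ 1 for the base instance, c ≤ K for the K perturbed ones)
-- and which beats the average  (K+K)·(q-p)/q  must have i = 1 and c ≥ K/q.
score-dichotomy : ∀ {p q K i c} → 2 * p < q → 0 < K → i ≤ 1 → c ≤ K →
  (K + K) * q ≤ (K + K) * p + q * (K * i + c) → (i ≡ 1) × (K ≤ q * c)
score-dichotomy {p} {q} {K} {c = c} 2p<q 0<K z≤n c≤K bound =
  contradiction (*-cancelˡ-≤ K Kq≤K2p) (<⇒≱ 2p<q)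
  where
  instance
    K≢0 : NonZero K
    K≢0 = >-nonZero 0<K
  open ≤-Reasoning
  Kq≤K2p : K * q ≤ K * (2 * p)
  Kq≤K2p = +-cancelʳ-≤ (K * q) (K * q) (K * (2 * p)) (begin
    K * q + K * q               ≡⟨ solve (K ∷ q ∷ []) ⟩
    (K + K) * q                 ≤⟨ bound ⟩
    (K + K) * p + q * (K * 0 + c) ≡⟨ solve (K ∷ p ∷ q ∷ c ∷ []) ⟩
    K * (2 * p) + q * c         ≤⟨ +-monoʳ-≤ (K * (2 * p)) (*-monoʳ-≤ q c≤K) ⟩
    K * (2 * p) + q * K         ≡⟨ cong (K * (2 * p) +_) (*-comm q K) ⟩
    K * (2 * p) + K * q         ∎)
score-dichotomy {p} {q} {K} {c = c} 2p<q 0<K (s≤s z≤n) c≤K bound =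
  refl , +-cancelʳ-≤ (K * (2 * p)) K (q * c) (begin
    K + K * (2 * p)      ≡⟨ solve (K ∷ p ∷ []) ⟩
    K * suc (2 * p)      ≤⟨ *-monoʳ-≤ K 2p<q ⟩
    K * q                ≤⟨ +-cancelʳ-≤ (K * q) (K * q) (K * (2 * p) + q * c) twice ⟩
    K * (2 * p) + q * c  ≡⟨ +-comm (K * (2 * p)) (q * c) ⟩
    q * c + K * (2 * p)  ∎)
  where
  open ≤-Reasoning
  twice : K * q + K * q ≤ (K * (2 * p) + q * c) + K * q
  twice = begin
    K * q + K * q               ≡⟨ solve (K ∷ q ∷ []) ⟩
    (K + K) * q                 ≤⟨ bound ⟩
    (K + K) * p + q * (K * 1 + c) ≡⟨ solve (K ∷ p ∷ q ∷ c ∷ []) ⟩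
    (K * (2 * p) + q * c) + K * q ∎

-- V lists all seeds, g₀ holds the seeds that are
-- good for a base instance and g k those good for the k-th of K further
-- instances; each set has density at least 1 - p/q > 1/2.  Scoring a seed by
-- the number of pairs (base, k) it is good on, the best seed scores at least
-- the average, which forces it to be good on the base instance and on at
-- least K/q of the others.
module Averaging {X : Set} (_≟_ : DecidableEquality X) (V : List X) (complete : ∀ x → x ∈ V) where

  open DecMembership _≟_ using (_∈?_)
  open Counting _≟_

  -- (The point of X only rules out the empty seed space.)
  good-seed : ∀ {p q K} → 2 * p < q → 0 < K → X →
    (g₀ : List X) (g : Fin K → List X) → Unique g₀ → (∀ k → Unique (g k)) →
    q * length V ≤ p * length V + q * length g₀ →
    (∀ k → q * length V ≤ p * length V + q * length (g k)) →
    Σ X λ s → s ∈ g₀ × K ≤ q * ∑[ k < K ] 𝟙 (s ∈? g k)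
  good-seed {p} {q} {K} 2p<q 0<K x₀ g₀ g unique₀ unique dense₀ dense =
    s , 𝟙-witness (s ∈? g₀) (subst (0 <_) (sym (proj₁ dichotomy)) (s≤s z≤n)) , proj₂ dichotomy
    where
    open ≤-Reasoning
    R : ℕ
    R = length V

    pairScore : Fin K → X → ℕ
    pairScore k s = 𝟙 (s ∈? g₀) + 𝟙 (s ∈? g k)

    score : X → ℕ
    score s = ∑[ k < K ] pairScore k s

    pair-bound : ∀ k → q * (R + R) ≤ p * (R + R) + q * sumOver V (pairScore k)
    pair-bound k = begin
      q * (R + R)                                       ≡⟨ *-distribˡ-+ q R R ⟩
      q * R + q * R                                     ≤⟨ +-mono-≤ dense₀ (dense k) ⟩
      (p * R + q * length g₀) + (p * R + q * length (g k))
        ≡⟨ regroup p q R (length g₀) (length (g k)) ⟩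
      p * (R + R) + q * (length g₀ + length (g k))      ≤⟨ +-monoʳ-≤ (p * (R + R)) (*-monoʳ-≤ q counted) ⟩
      p * (R + R) + q * sumOver V (pairScore k)         ∎
      where
      regroup : ∀ p q R a b → (p * R + q * a) + (p * R + q * b) ≡ p * (R + R) + q * (a + b)
      regroup = solve-∀
      counted : length g₀ + length (g k) ≤ sumOver V (pairScore k)
      counted = ≤-trans (+-mono-≤ (length≤count V complete unique₀) (length≤count V complete (unique k)))
                        (≤-reflexive (sym (sumOver-+ V (λ s → 𝟙 (s ∈? g₀)) (λ s → 𝟙 (s ∈? g k)))))

    total-bound : K * (q * (R + R)) ≤ K * (p * (R + R)) + q * sumOver V score
    total-bound = begin
      K * (q * (R + R))                                       ≡⟨ sym (∑-const K (q * (R + R))) ⟩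
      ∑[ k < K ] (q * (R + R))                                ≤⟨ ∑-mono-≤ _ _ pair-bound ⟩
      ∑[ k < K ] (p * (R + R) + q * sumOver V (pairScore k))  ≡⟨ ∑-distrib-+ (λ _ → p * (R + R)) (λ k → q * sumOver V (pairScore k)) ⟩
      ∑[ k < K ] (p * (R + R)) + ∑[ k < K ] (q * sumOver V (pairScore k))
        ≡⟨ cong₂ _+_ (∑-const K (p * (R + R))) (sym (*-distribˡ-sum q (λ k → sumOver V (pairScore k)))) ⟩
      K * (p * (R + R)) + q * ∑[ k < K ] sumOver V (pairScore k)
        ≡⟨ cong (λ n → K * (p * (R + R)) + q * n) (sym (sumOver-∑ V (λ s k → pairScore k s))) ⟩
      K * (p * (R + R)) + q * sumOver V score                 ∎

    best : Σ X λ s → sumOver V score ≤ R * score s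
    best = sumOver≤max score x₀ V

    s : X
    s = proj₁ best

    instance
      R≢0 : NonZero R
      R≢0 = >-nonZero (nonempty (complete x₀))
        where
        nonempty : ∀ {x} {xs : List X} → x ∈ xs → 0 < length xs
        nonempty (here _) = s≤s z≤n
        nonempty (there _) = s≤s z≤n

    beats-average : (K + K) * q ≤ (K + K) * p + q * score s
    beats-average = *-cancelʳ-≤ ((K + K) * q) ((K + K) * p + q * score s) R (begin
      (K + K) * q * R                           ≡⟨ lhs-form K q R ⟩
      K * (q * (R + R))                         ≤⟨ total-bound ⟩
      K * (p * (R + R)) + q * sumOver V score   ≤⟨ +-monoʳ-≤ (K * (p * (R + R))) (*-monoʳ-≤ q (proj₂ best)) ⟩
      K * (p * (R + R)) + q * (R * score s)     ≡⟨ rhs-form K p q R (score s) ⟩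
      ((K + K) * p + q * score s) * R           ∎)
      where
      lhs-form : ∀ K q R → (K + K) * q * R ≡ K * (q * (R + R))
      lhs-form = solve-∀
      rhs-form : ∀ K p q R x → K * (p * (R + R)) + q * (R * x) ≡ ((K + K) * p + q * x) * R
      rhs-form = solve-∀

    score-split : score s ≡ K * 𝟙 (s ∈? g₀) + ∑[ k < K ] 𝟙 (s ∈? g k)
    score-split = trans (∑-distrib-+ (λ _ → 𝟙 (s ∈? g₀)) (λ k → 𝟙 (s ∈? g k)))
                        (cong (_+ ∑[ k < K ] 𝟙 (s ∈? g k)) (∑-const K (𝟙 (s ∈? g₀))))

    others≤K : ∑[ k < K ] 𝟙 (s ∈? g k) ≤ K
    others≤K = ≤-trans (∑-mono-≤ _ _ (λ k → 𝟙≤1 (s ∈? g k))) (≤-reflexive (trans (∑-const K 1) (*-identityʳ K)))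

    dichotomy : (𝟙 (s ∈? g₀) ≡ 1) × (K ≤ q * ∑[ k < K ] 𝟙 (s ∈? g k))
    dichotomy = score-dichotomy 2p<q 0<K (𝟙≤1 (s ∈? g₀)) others≤K
      (subst (λ n → (K + K) * q ≤ (K + K) * p + q * n) score-split beats-average)

-- The number of queries, along the run of t on G, that inspect the
-- adjacency of character k (as the text character of a match,
-- degree or neighbour query, or as the pattern character of a degree query).
queries : ∀ {σ} → Graph σ σ → Tree σ σ → Fin σ → ℕ
queries G (leaf _) k = 0
queries G (qMatch a b t) k = 𝟙 (a ≟F k) + queries G (t (matchOracle G a b)) k
queries G (qDegT a t) k = 𝟙 (a ≟F k) + queries G (t (degT G a)) k
queries G (qDegP b t) k = 𝟙 (b ≟F k) + queries G (t (degP G b)) k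
queries G (qNbr a i t) k = 𝟙 (a ≟F k) + queries G (t (nbr G a i)) k

∑-one-more : ∀ {σ} (a : Fin σ) (u : Fin σ → ℕ) → ∑[ k < σ ] (𝟙 (a ≟F k) + u k) ≡ suc (∑[ k < σ ] u k)
∑-one-more a u = trans (∑-distrib-+ (λ k → 𝟙 (a ≟F k)) u) (cong (_+ ∑[ k < _ ] u k) (∑-𝟙≟ a))

-- Every query inspects exactly one character, so the counts add up to the cost.
∑-queries : ∀ {σ} (G : Graph σ σ) (t : Tree σ σ) → ∑[ k < σ ] queries G t k ≡ cost G t
∑-queries {σ} G (leaf _) = sum-replicate-zero σ
∑-queries G (qMatch a b t) =
  trans (∑-one-more a (queries G (t (matchOracle G a b)))) (cong suc (∑-queries G (t (matchOracle G a b))))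
∑-queries G (qDegT a t) =
  trans (∑-one-more a (queries G (t (degT G a)))) (cong suc (∑-queries G (t (degT G a))))
∑-queries G (qDegP b t) =
  trans (∑-one-more b (queries G (t (degP G b)))) (cong suc (∑-queries G (t (degP G b))))
∑-queries G (qNbr a i t) =
  trans (∑-one-more a (queries G (t (nbr G a i)))) (cong suc (∑-queries G (t (nbr G a i))))

record AgreeAwayFrom {σ} (k : Fin σ) (G G′ : Graph σ σ) : Set where
  field
    adj-agrees  : ∀ a → a ≢ k → adj G a ≡ adj G′ a
    degP-agrees : ∀ b → b ≢ k → degP G b ≡ degP G′ b

module _ {σ} {k : Fin σ} {G G′ : Graph σ σ} (agree : AgreeAwayFrom k G G′) where

  open AgreeAwayFrom agree
  open DecMembership (_≟F_ {σ}) using (_∈?_)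

  private
    avoids : ∀ (a : Fin σ) {n} → 𝟙 (a ≟F k) + n ≡ 0 → a ≢ k
    avoids a none = 𝟙≡0⇒¬ (a ≟F k) (m+n≡0⇒m≡0 _ none)

  unqueried-agree : ∀ t → queries G t k ≡ 0 → output G t ≡ output G′ t
  unqueried-agree (leaf _) _ = refl
  unqueried-agree (qMatch a b t) none =
    trans (unqueried-agree (t (matchOracle G a b)) (m+n≡0⇒n≡0 _ none))
          (cong (λ l → output G′ (t (does (b ∈? l)))) (adj-agrees a (avoids a none)))
  unqueried-agree (qDegT a t) none =
    trans (unqueried-agree (t (degT G a)) (m+n≡0⇒n≡0 _ none))
          (cong (λ l → output G′ (t (length l))) (adj-agrees a (avoids a none)))
  unqueried-agree (qDegP b t) none =
    trans (unqueried-agree (t (degP G b)) (m+n≡0⇒n≡0 _ none))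
          (cong (λ d → output G′ (t d)) (degP-agrees b (avoids b none)))
  unqueried-agree (qNbr a i t) none =
    trans (unqueried-agree (t (nbr G a i)) (m+n≡0⇒n≡0 _ none))
          (cong (λ l → output G′ (t (head (drop i l)))) (adj-agrees a (avoids a none)))

diagonal : ∀ K → Graph K K → Instance
diagonal K G = record { σT = K ; σP = K ; n = K ; m = K ; T = allFinV K ; P = allFinV K ; G = G }

identityGraph : ∀ K → Graph K K
identityGraph K = record { adj = λ a → a ∷ [] ; adjUniq = λ a → [] ∷ [] }

withoutLoopAt : ∀ {K} → Fin K → Fin K → List (Fin K)
withoutLoopAt k a with a ≟F k
... | yes _ = []
... | no _ = a ∷ []

withoutLoopAt-≢ : ∀ {K} (k a : Fin K) → a ≢ k → withoutLoopAt k a ≡ a ∷ []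
withoutLoopAt-≢ k a a≢k with a ≟F k
... | yes a≡k = contradiction a≡k a≢k
... | no _ = refl

withoutLoopAt-self : ∀ {K} (k : Fin K) → withoutLoopAt k k ≡ []
withoutLoopAt-self k with k ≟F k
... | yes _ = refl
... | no k≢k = contradiction refl k≢k

identityWithout : ∀ K → Fin K → Graph K K
identityWithout K k = record { adj = withoutLoopAt k ; adjUniq = unique }
  where
  unique : ∀ a → Unique (withoutLoopAt k a)
  unique a with a ≟F k
  ... | yes _ = []
  ... | no _ = [] ∷ []

identityWithout-agrees : ∀ K (k : Fin K) → AgreeAwayFrom k (identityGraph K) (identityWithout K k)
identityWithout-agrees K k = record
  { adj-agrees = λ a a≢k → sym (withoutLoopAt-≢ k a a≢k)
  ; degP-agrees = λ b b≢k → cong length (filter-≐ _ _ (same-neighbourhood b b≢k) (allFin K))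
  }
  where
  same-neighbourhood : ∀ b → b ≢ k → (λ a → b ∈ a ∷ []) ≐ (λ a → b ∈ withoutLoopAt k a)
  same-neighbourhood b b≢k = (λ {a} → to a) , (λ {a} → from a)
    where
    to : ∀ a → b ∈ a ∷ [] → b ∈ withoutLoopAt k a
    to a (here refl) = subst (b ∈_) (sym (withoutLoopAt-≢ k b b≢k)) (here refl)
    from : ∀ a → b ∈ withoutLoopAt k a → b ∈ a ∷ []
    from a b∈ with a ≟F k
    ... | no _ = b∈

edges-identity : ∀ K → edges (identityGraph K) ≡ K
edges-identity K = trans (sum-ones (allFin K)) (length-tabulate (λ a → a))
  where
  sum-ones : ∀ {A : Set} (xs : List A) → sum (map (λ _ → 1) xs) ≡ length xs
  sum-ones [] = refl
  sum-ones (_ ∷ xs) = cong suc (sum-ones xs)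

!?-lookup : ∀ {A : Set} {n} (v : Vec A n) (j : Fin n) → v !? toℕ j ≡ just (lookup v j)
!?-lookup (x ∷v v) zero = refl
!?-lookup (x ∷v v) (suc j) = !?-lookup v j

diagonal-at : ∀ K (j : Fin K) → allFinV K !? toℕ j ≡ just j
diagonal-at K j = trans (!?-lookup (allFinV K) j) (cong just (lookup-allFin j))

occurs-at-0 : ∀ K (G : Graph K K) → (∀ j → Matches G j j) → Occ (diagonal K G) 0
occurs-at-0 K G loops = ≤-refl , λ j → subst₂ (MatchAt G) (sym (diagonal-at K j)) (sym (lookup-allFin j)) (loops j)

no-occurrence-at-0 : ∀ K (G : Graph K K) (k : Fin K) → ¬ Matches G k k → ¬ Occ (diagonal K G) 0
no-occurrence-at-0 K G k no-loop (_ , matches) =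
  no-loop (subst₂ (MatchAt G) (diagonal-at K k) (lookup-allFin k) (matches k))

identity-loops : ∀ K (j : Fin K) → Matches (identityGraph K) j j
identity-loops K j = here refl

identityWithout-no-loop : ∀ K (k : Fin K) → ¬ Matches (identityWithout K k) k k
identityWithout-no-loop K k loop with subst (k ∈_) (withoutLoopAt-self k) loop
... | ()

module LowerBound {p q : ℕ} (2p<q : 2 * p < q) (A : Alg) (err : ErrorAtMost A p q) (K : ℕ) (0<K : 0 < K) where

  r : ℕ
  r = seeds A (diagonal K (identityGraph K))

  run : Vec Bool r → Tree K K
  run = treeOf A (diagonal K (identityGraph K))

  good : Graph K K → List (Vec Bool r)
  good G = proj₁ (err (diagonal K G))

  good-unique : ∀ G → Unique (good G)
  good-unique G = proj₁ (proj₂ (err (diagonal K G)))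

  good-dense : ∀ G → q * length (allSeeds r) ≤ p * length (allSeeds r) + q * length (good G)
  good-dense G = subst (λ R → q * R ≤ p * R + q * length (good G)) (sym (allSeeds-length r))
                       (proj₁ (proj₂ (proj₂ (err (diagonal K G)))))

  good-correct : ∀ G s → s ∈ good G → CorrectOutput (diagonal K G) (output G (run s))
  good-correct G = proj₂ (proj₂ (proj₂ (err (diagonal K G))))

  open DecMembership (≡-dec {n = r} _≟B_) using (_∈?_)
  open Averaging (≡-dec {n = r} _≟B_) (allSeeds r) (allSeeds-complete r)

  -- On the identity graph the run of a good seed reports position 0; on the
  -- graph without loop k it must not, so the run must have inspected k.
  good-on-both⇒queries : ∀ k s → s ∈ good (identityGraph K) → s ∈ good (identityWithout K k) →
              0 < queries (identityGraph K) (run s) k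
  good-on-both⇒queries k s good₀ goodₖ = n≢0⇒n>0 λ none →
    no-occurrence-at-0 K (identityWithout K k) k (identityWithout-no-loop K k)
      (proj₁ (good-correct (identityWithout K k) s goodₖ 0)
        (subst (0 ∈_) (unqueried-agree (identityWithout-agrees K k) (run s) none) reports-0))
    where
    reports-0 : 0 ∈ output (identityGraph K) (run s)
    reports-0 = proj₂ (good-correct (identityGraph K) s good₀ 0) (occurs-at-0 K (identityGraph K) (identity-loops K))

  expensive-seed : Σ (Vec Bool r) λ s → K ≤ q * cost (identityGraph K) (run s)
  expensive-seed = s , (begin
    K                                                       ≤⟨ many-good ⟩
    q * ∑[ k < K ] 𝟙 (s ∈? good (identityWithout K k))      ≤⟨ *-monoʳ-≤ q (∑-mono-≤ _ _ good⇒queried) ⟩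
    q * ∑[ k < K ] queries (identityGraph K) (run s) k      ≡⟨ cong (q *_) (∑-queries (identityGraph K) (run s)) ⟩
    q * cost (identityGraph K) (run s)                      ∎)
    where
    open ≤-Reasoning
    seed : Σ (Vec Bool r) λ s → s ∈ good (identityGraph K) × K ≤ q * ∑[ k < K ] 𝟙 (s ∈? good (identityWithout K k))
    seed = good-seed {p} {q} {K} 2p<q 0<K (replicate r false) (good (identityGraph K)) (λ k → good (identityWithout K k))
             (good-unique (identityGraph K)) (λ k → good-unique (identityWithout K k))
             (good-dense (identityGraph K)) (λ k → good-dense (identityWithout K k))
    s : Vec Bool r
    s = proj₁ seed
    many-good : K ≤ q * ∑[ k < K ] 𝟙 (s ∈? good (identityWithout K k))
    many-good = proj₂ (proj₂ seed)
    good⇒queried : ∀ k → 𝟙 (s ∈? good (identityWithout K k)) ≤ queries (identityGraph K) (run s) k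
    good⇒queried k with s ∈? good (identityWithout K k)
    ... | yes goodₖ = good-on-both⇒queries k s (proj₁ (proj₂ seed)) goodₖ
    ... | no _ = z≤n

lemma4p2 : ∀ (p q : ℕ) → 2 * p < q →
    ∃ λ (c1 : ℕ) → ∃ λ (c2 : ℕ) → (0 < c1) × (0 < c2) ×
      (∀ (A : Alg) → ErrorAtMost A p q →
        ∀ (N : ℕ) → Σ Instance λ I → (N ≤ edges (G I)) × WorstTimeAtLeast A I c1 c2)
lemma4p2 p q 2p<q = 1 , q , s≤s z≤n , ≤-trans (s≤s z≤n) 2p<q , hard-instance
  where
  hard-instance : ∀ A → ErrorAtMost A p q → ∀ N →
                  Σ Instance λ I → (N ≤ edges (G I)) × WorstTimeAtLeast A I 1 q
  hard-instance A err N =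
    diagonal K (identityGraph K) ,
    subst (N ≤_) (sym (edges-identity K)) (n≤1+n N) ,
    s , subst (_≤ q * cost (identityGraph K) (run s)) (sym S≡K) K≤q·cost
    where
    K : ℕ
    K = suc N
    open LowerBound {p} {q} 2p<q A err K (s≤s z≤n) using (r; run; expensive-seed)
    s : Vec Bool r
    s = proj₁ expensive-seed
    K≤q·cost : K ≤ q * cost (identityGraph K) (run s)
    K≤q·cost = proj₂ expensive-seed
    S≡K : 1 * edges (identityGraph K) ≡ K
    S≡K = trans (*-identityˡ _) (edges-identity K)
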